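{- Let $w_1,w_2,w_3$ be any odd positive integers and let $n\ge 0$ be an integer. Then \begin{align*} &\sum_{k+l+m=n}\binom{n}{k,l,m}T_k(w_1d-1;\chi,\xi^{w_3})T_l(w_2d-1;\chi,\xi^{w_1})T_m(w_3d-1;\chi,\xi^{w_2})\,w_{3}^{k}w_{1}^{l}w_{2}^{m}\\ =&\sum_{k+l+m=n}\binom{n}{k,l,m}T_k(w_1d-1;\chi,\xi^{w_2})T_l(w_3d-1;\chi,\xi^{w_1})T_m(w_2d-1;\chi,\xi^{w_3})\,w_{2}^{k}w_{1}^{l}w_{3}^{m}. \end{align*}
   Context: Let $p$ be a fixed odd prime and $\mathbb{C}_p$ the completion of an algebraic closure of $\mathbb{Q}_p$. Let $\xi\in\mathbb{C}_p$ be a fixed ramified root of unity, i.e. $\xi^{p^s}=1$ for some positive integer $s$. Let $d$ be a fixed odd positive integer and $\chi$ a primitive Dirichlet character of conductor $d$, regarded as a function on the integers (periodic mod $d$, zero on integers not coprime to $d$) with values in $\mathbb{C}_p$ via a fixed embedding $\overline{\mathbb{Q}}\to\mathbb{C}_p$. For a root of unity $\zeta$ (e.g. $\zeta=\xi^w$), the alternating generalized twisted power sum is $T_k(N;\chi,\zeta)=\sum_{a=0}^{N}(-1)^a\chi(a)\zeta^a a^k$ (with $0^0=1$). The sums are over nonnegative integers $k,l,m$ with $k+l+m=n$, and $\binom{n}{k,l,m}=\frac{n!}{k!\,l!\,m!}$. -}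

module Defs where

open import Level using (Level)
open import Data.Nat as ℕ using (ℕ; zero; suc; _∸_; _<_; _!)
open import Data.Nat.Combinatorics using (_C_)
open import Data.Nat.Divisibility using (_∣_)
open import Data.Nat.GCD using (gcd)
open import Data.Product using (∃; _×_)
open import Relation.Binary.PropositionalEquality using (_≡_; _≢_)
open import Relation.Nullary using (¬_)
open import Algebra.Bundles using (CommutativeRing)

Odd : ℕ → Set
Odd n = ∃ λ k → n ≡ suc (2 ℕ.* k)

module _ {c ℓ : Level} (R : CommutativeRing c ℓ) where
  open CommutativeRing R

  fromℕ : ℕ → Carrier
  fromℕ zero = 0#
  fromℕ (suc n) = 1# + fromℕ n

  -- powers, with x ^ 0 = 1 (so 0 ^ 0 = 1)
  pow : Carrier → ℕ → Carrier
  pow x zero = 1#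
  pow x (suc n) = x * pow x n

  sumTo : ℕ → (ℕ → Carrier) → Carrier
  sumTo zero f = f 0
  sumTo (suc N) f = sumTo N f + f (suc N)

  T : ℕ → ℕ → (ℕ → Carrier) → Carrier → Carrier
  T k N χ ζ = sumTo N (λ a → pow (- 1#) a * χ a * pow ζ a * pow (fromℕ a) k)

  -- multinomial coefficient n!/(k! l! m!) for k + l + m = n, written as
  -- the (equal) product of binomials C(n,k) C(n-k,l)
  multinomial : ℕ → ℕ → ℕ → Carrier
  multinomial n k l = fromℕ ((n C k) ℕ.* ((n ∸ k) C l))

  -- Σ_{k+l+m=n} F k l m
  sumKLM : ℕ → (ℕ → ℕ → ℕ → Carrier) → Carrier
  sumKLM n F = sumTo n (λ k → sumTo (n ∸ k) (λ l → F k l (n ∸ k ∸ l)))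

  CharZero : Set ℓ
  CharZero = ∀ n → fromℕ n ≈ 0# → n ≡ 0

  IsFieldR : Set (c Level.⊔ ℓ)
  IsFieldR = (¬ (1# ≈ 0#)) × (∀ x → ¬ (x ≈ 0#) → ∃ λ y → x * y ≈ 1#)

  -- χ : ℕ → R is a Dirichlet character modulo d (restricted to the
  -- nonnegative integers, which is all the statement uses)
  record IsDirichletChar (d : ℕ) (χ : ℕ → Carrier) : Set (c Level.⊔ ℓ) where
    field
      periodic       : ∀ a → χ (a ℕ.+ d) ≈ χ a
      multiplicative : ∀ a b → χ (a ℕ.* b) ≈ χ a * χ b
      one            : χ 1 ≈ 1#
      zero-nonunit   : ∀ a → gcd a d ≢ 1 → χ a ≈ 0#
      nonzero-unit   : ∀ a → gcd a d ≡ 1 → ¬ (χ a ≈ 0#)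

  -- χ is induced by a character modulo d' : χ(a) = 1 whenever
  -- gcd(a,d) = 1 and a ≡ 1 (mod d')
  InducedMod : ℕ → ℕ → (ℕ → Carrier) → Set ℓ
  InducedMod d d' χ = ∀ a → gcd a d ≡ 1 → (∃ λ q → a ≡ suc (q ℕ.* d')) → χ a ≈ 1#

  record IsPrimitiveChar (d : ℕ) (χ : ℕ → Carrier) : Set (c Level.⊔ ℓ) where
    field
      isChar    : IsDirichletChar d χ
      isPrimitive : ∀ d' → d' ∣ d → d' < d → ¬ InducedMod d d' χ

{-# OPTIONS --safe #-}

-- By the multinomial theorem each side is Σ ε(a) ε(b) ε(c) F(y) over a box of size
-- w₁d × w₂d × w₃d, where ε(a) = (-1)^a χ(a), F(y) = ξ^y y^n and y is a weighted sum of
-- a, b, c; that is, the value at 0 of three commuting operators H ↦ Σ_{a < N} ε(a) H(x + u a)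
-- applied to F.  As d is odd and χ has period d, ε(a + d) = -ε(a), so for odd w the
-- operator of length w d composed with Δ_{ud} H(x) = H(x) + H(x + ud) telescopes to the
-- operator of length d composed with Δ_{uwd}.  Every Δ_v with v ≠ 0 is surjective, so
-- F = Δ_{w₁d} Δ_{w₂d} Δ_{w₃d} H, and both sides become the same composite of three
-- operators of length d and the shifts Δ_{w₁w₂d}, Δ_{w₂w₃d}, Δ_{w₃w₁d}.
module Submission where

open import Defs
open import Level using (Level; _⊔_)
open import Algebra.Bundles using (CommutativeRing; CommutativeMonoid)
import Algebra.Properties.CommutativeSemigroup
import Data.Nat as ℕ
open ℕ using (ℕ; zero; suc; _∸_; NonZero)
import Data.Nat.Properties as NP
open NP using (m*n≢0)
open import Data.Nat.Combinatorics using (_C_)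
open import Data.Nat.DivMod using (_/_; _%_; [m+n]%n≡m%n; m≡m%n+[m/n]*n; m/n≡1+[m∸n]/n)
open import Data.Fin using (toℕ)
open import Data.List using (List; []; _∷_; _++_; foldr)
import Data.List.Properties as ListP
open import Data.Product using (∃; _,_)
open import Relation.Binary.PropositionalEquality as ≡ using (_≡_)

module ℕ+ = Algebra.Properties.CommutativeSemigroup NP.+-commutativeSemigroup
module ℕ* = Algebra.Properties.CommutativeSemigroup NP.*-commutativeSemigroup

x+ua+ub≡x+u[a+b] : ∀ x u a b → x ℕ.+ u ℕ.* a ℕ.+ u ℕ.* b ≡ x ℕ.+ u ℕ.* (a ℕ.+ b)
x+ua+ub≡x+u[a+b] x u a b = ≡.trans (NP.+-assoc x _ _) (≡.cong (x ℕ.+_) (≡.sym (NP.*-distribˡ-+ u a b)))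

module CastsAndPowers {c ℓ : Level} (R : CommutativeRing c ℓ) where
  open CommutativeRing R
  open import Relation.Binary.Reasoning.Setoid setoid
  open import Algebra.Properties.Ring ring using (-1*x≈-x; -‿involutive)
  open import Algebra.Properties.Semiring.Mult semiring using (_×_; ×-congʳ; ×-homo-+; ×1-homo-*; ×-assoc-*)
  open import Algebra.Properties.Semiring.Exp semiring using (_^_; ^-congˡ; ^-homo-*; ^-assocʳ)
  open import Algebra.Properties.CommutativeSemiring.Exp commutativeSemiring using (^-distrib-*)

  fromℕ≈×1# : ∀ n → fromℕ R n ≈ n × 1#
  fromℕ≈×1# zero    = refl
  fromℕ≈×1# (suc n) = +-congˡ (fromℕ≈×1# n)

  fromℕ-+ : ∀ m n → fromℕ R (m ℕ.+ n) ≈ fromℕ R m + fromℕ R n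
  fromℕ-+ m n = trans (fromℕ≈×1# (m ℕ.+ n)) (trans (×-homo-+ 1# m n) (sym (+-cong (fromℕ≈×1# m) (fromℕ≈×1# n))))

  fromℕ-* : ∀ m n → fromℕ R (m ℕ.* n) ≈ fromℕ R m * fromℕ R n
  fromℕ-* m n = trans (fromℕ≈×1# (m ℕ.* n)) (trans (×1-homo-* m n) (sym (*-cong (fromℕ≈×1# m) (fromℕ≈×1# n))))

  ×≈fromℕ-* : ∀ n x → n × x ≈ fromℕ R n * x
  ×≈fromℕ-* n x = trans (×-congʳ n (sym (*-identityˡ x))) (trans (sym (×-assoc-* n 1# x)) (*-congʳ (sym (fromℕ≈×1# n))))

  pow≈^ : ∀ x n → pow R x n ≈ x ^ n
  pow≈^ x zero    = refl
  pow≈^ x (suc n) = *-congˡ (pow≈^ x n)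

  pow-cong : ∀ n {x y} → x ≈ y → pow R x n ≈ pow R y n
  pow-cong n x≈y = trans (pow≈^ _ n) (trans (^-congˡ n x≈y) (sym (pow≈^ _ n)))

  pow-+ : ∀ x m n → pow R x (m ℕ.+ n) ≈ pow R x m * pow R x n
  pow-+ x m n = trans (pow≈^ x (m ℕ.+ n)) (trans (^-homo-* x m n) (sym (*-cong (pow≈^ x m) (pow≈^ x n))))

  pow-pow : ∀ x m n → pow R (pow R x m) n ≈ pow R x (m ℕ.* n)
  pow-pow x m n = trans (pow≈^ (pow R x m) n) (trans (^-congˡ n (pow≈^ x m)) (trans (^-assocʳ x m n) (sym (pow≈^ x (m ℕ.* n)))))

  pow-distrib-* : ∀ x y n → pow R (x * y) n ≈ pow R x n * pow R y n
  pow-distrib-* x y n = trans (pow≈^ (x * y) n) (trans (^-distrib-* x y n) (sym (*-cong (pow≈^ x n) (pow≈^ y n))))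

  pow-1# : ∀ n → pow R 1# n ≈ 1#
  pow-1# zero    = refl
  pow-1# (suc n) = trans (*-identityˡ _) (pow-1# n)

  pow-neg-1#-odd : ∀ {n} → Odd n → pow R (- 1#) n ≈ - 1#
  pow-neg-1#-odd (k , ≡.refl) = begin
    - 1# * pow R (- 1#) (2 ℕ.* k)     ≈⟨ *-congˡ (sym (pow-pow (- 1#) 2 k)) ⟩
    - 1# * pow R (- 1# * (- 1# * 1#)) k ≈⟨ *-congˡ (pow-cong k (trans (*-congˡ (*-identityʳ _)) square)) ⟩
    - 1# * pow R 1# k                 ≈⟨ *-congˡ (pow-1# k) ⟩
    - 1# * 1#                          ≈⟨ *-identityʳ _ ⟩
    - 1# ∎
    where
    square : - 1# * - 1# ≈ 1#
    square = trans (-1*x≈-x (- 1#)) (-‿involutive 1#)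

module FiniteSums {c ℓ : Level} (R : CommutativeRing c ℓ) where
  open CommutativeRing R
  open import Relation.Binary.Reasoning.Setoid setoid
  open import Algebra.Properties.CommutativeSemigroup +-commutativeSemigroup using () renaming (interchange to +-interchange)

  sumBelow : ℕ → (ℕ → Carrier) → Carrier
  sumBelow zero    f = 0#
  sumBelow (suc n) f = sumBelow n f + f n

  sumBelow-cong : ∀ n {f g : ℕ → Carrier} → (∀ a → f a ≈ g a) → sumBelow n f ≈ sumBelow n g
  sumBelow-cong zero    f≈g = refl
  sumBelow-cong (suc n) f≈g = +-cong (sumBelow-cong n f≈g) (f≈g n)

  sumBelow-zero : ∀ n → sumBelow n (λ _ → 0#) ≈ 0#
  sumBelow-zero zero    = refl
  sumBelow-zero (suc n) = trans (+-identityʳ _) (sumBelow-zero n)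

  sumBelow-distrib-+ : ∀ n f g → sumBelow n (λ a → f a + g a) ≈ sumBelow n f + sumBelow n g
  sumBelow-distrib-+ zero    f g = sym (+-identityˡ 0#)
  sumBelow-distrib-+ (suc n) f g = trans (+-congʳ (sumBelow-distrib-+ n f g)) (+-interchange _ _ _ _)

  *-distribˡ-sumBelow : ∀ n x f → x * sumBelow n f ≈ sumBelow n (λ a → x * f a)
  *-distribˡ-sumBelow zero    x f = zeroʳ x
  *-distribˡ-sumBelow (suc n) x f = trans (distribˡ x _ _) (+-congʳ (*-distribˡ-sumBelow n x f))

  *-distribʳ-sumBelow : ∀ n x f → sumBelow n f * x ≈ sumBelow n (λ a → f a * x)
  *-distribʳ-sumBelow zero    x f = zeroˡ x
  *-distribʳ-sumBelow (suc n) x f = trans (distribʳ x _ _) (+-congʳ (*-distribʳ-sumBelow n x f))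

  sumBelow-comm : ∀ m n (f : ℕ → ℕ → Carrier) →
    sumBelow m (λ a → sumBelow n (f a)) ≈ sumBelow n (λ b → sumBelow m (λ a → f a b))
  sumBelow-comm zero    n f = sym (sumBelow-zero n)
  sumBelow-comm (suc m) n f = trans (+-congʳ (sumBelow-comm m n f)) (sym (sumBelow-distrib-+ n _ (f m)))

  sumBelow-split : ∀ m n f → sumBelow (m ℕ.+ n) f ≈ sumBelow m f + sumBelow n (λ r → f (m ℕ.+ r))
  sumBelow-split m zero    f = trans (reflexive (≡.cong (λ k → sumBelow k f) (NP.+-identityʳ m))) (sym (+-identityʳ _))
  sumBelow-split m (suc n) f = begin
    sumBelow (m ℕ.+ suc n) f ≡⟨ ≡.cong (λ k → sumBelow k f) (NP.+-suc m n) ⟩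
    sumBelow (m ℕ.+ n) f + f (m ℕ.+ n) ≈⟨ +-congʳ (sumBelow-split m n f) ⟩
    (sumBelow m f + sumBelow n (λ r → f (m ℕ.+ r))) + f (m ℕ.+ n) ≈⟨ +-assoc _ _ _ ⟩
    sumBelow m f + sumBelow (suc n) (λ r → f (m ℕ.+ r)) ∎

  sumBelow-product₃ : ∀ l m n f g h →
    sumBelow l f * (sumBelow m g * sumBelow n h)
      ≈ sumBelow l (λ a → sumBelow m (λ b → sumBelow n (λ c → f a * (g b * h c))))
  sumBelow-product₃ l m n f g h = begin
    sumBelow l f * (sumBelow m g * sumBelow n h)
      ≈⟨ *-distribʳ-sumBelow l _ f ⟩
    sumBelow l (λ a → f a * (sumBelow m g * sumBelow n h))
      ≈⟨ sumBelow-cong l (λ a → *-congˡ (*-distribʳ-sumBelow m _ g)) ⟩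
    sumBelow l (λ a → f a * sumBelow m (λ b → g b * sumBelow n h))
      ≈⟨ sumBelow-cong l (λ a → *-distribˡ-sumBelow m (f a) _) ⟩
    sumBelow l (λ a → sumBelow m (λ b → f a * (g b * sumBelow n h)))
      ≈⟨ sumBelow-cong l (λ a → sumBelow-cong m (λ b → *-congˡ (*-distribˡ-sumBelow n (g b) h))) ⟩
    sumBelow l (λ a → sumBelow m (λ b → f a * sumBelow n (λ c → g b * h c)))
      ≈⟨ sumBelow-cong l (λ a → sumBelow-cong m (λ b → *-distribˡ-sumBelow n (f a) _)) ⟩
    sumBelow l (λ a → sumBelow m (λ b → sumBelow n (λ c → f a * (g b * h c)))) ∎

  sumBelow-factor₃ : ∀ l m n (x y z : ℕ → Carrier) (φ : ℕ → ℕ → ℕ → Carrier) →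
    sumBelow l (λ a → sumBelow m (λ b → sumBelow n (λ c → x a * (y b * (z c * φ a b c)))))
      ≈ sumBelow l (λ a → x a * sumBelow m (λ b → y b * sumBelow n (λ c → z c * φ a b c)))
  sumBelow-factor₃ l m n x y z φ = sumBelow-cong l (λ a → sym (begin
    x a * sumBelow m (λ b → y b * sumBelow n (λ c → z c * φ a b c))
      ≈⟨ *-distribˡ-sumBelow m (x a) _ ⟩
    sumBelow m (λ b → x a * (y b * sumBelow n (λ c → z c * φ a b c)))
      ≈⟨ sumBelow-cong m (λ b → trans (*-congˡ (*-distribˡ-sumBelow n (y b) _)) (*-distribˡ-sumBelow n (x a) _)) ⟩
    sumBelow m (λ b → sumBelow n (λ c → x a * (y b * (z c * φ a b c)))) ∎))

  sumTo≈sumBelow : ∀ n f → sumTo R n f ≈ sumBelow (suc n) f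
  sumTo≈sumBelow zero    f = sym (+-identityˡ (f 0))
  sumTo≈sumBelow (suc n) f = +-congʳ (sumTo≈sumBelow n f)

  sumTo-cong : ∀ n {f g : ℕ → Carrier} → (∀ a → f a ≈ g a) → sumTo R n f ≈ sumTo R n g
  sumTo-cong zero    f≈g = f≈g 0
  sumTo-cong (suc n) f≈g = +-cong (sumTo-cong n f≈g) (f≈g (suc n))

  *-distribˡ-sumTo : ∀ n x f → x * sumTo R n f ≈ sumTo R n (λ a → x * f a)
  *-distribˡ-sumTo zero    x f = refl
  *-distribˡ-sumTo (suc n) x f = trans (distribˡ x _ _) (+-congʳ (*-distribˡ-sumTo n x f))

  sumTo-suc : ∀ n f → sumTo R (suc n) f ≈ f 0 + sumTo R n (λ a → f (suc a))
  sumTo-suc zero    f = refl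
  sumTo-suc (suc n) f = trans (+-congʳ (sumTo-suc n f)) (+-assoc _ _ _)

  sumTo-comm-sumBelow : ∀ n m (f : ℕ → ℕ → Carrier) →
    sumTo R n (λ a → sumBelow m (f a)) ≈ sumBelow m (λ b → sumTo R n (λ a → f a b))
  sumTo-comm-sumBelow n m f = begin
    sumTo R n (λ a → sumBelow m (f a))               ≈⟨ sumTo≈sumBelow n _ ⟩
    sumBelow (suc n) (λ a → sumBelow m (f a))        ≈⟨ sumBelow-comm (suc n) m f ⟩
    sumBelow m (λ b → sumBelow (suc n) (λ a → f a b)) ≈⟨ sumBelow-cong m (λ b → sym (sumTo≈sumBelow n _)) ⟩
    sumBelow m (λ b → sumTo R n (λ a → f a b))        ∎

  sumKLM-cong : ∀ n {F G : ℕ → ℕ → ℕ → Carrier} → (∀ k l m → F k l m ≈ G k l m) → sumKLM R n F ≈ sumKLM R n G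
  sumKLM-cong n F≈G = sumTo-cong n (λ k → sumTo-cong (n ∸ k) (λ l → F≈G k l (n ∸ k ∸ l)))

  *-distribˡ-sumKLM : ∀ n x F → x * sumKLM R n F ≈ sumKLM R n (λ k l m → x * F k l m)
  *-distribˡ-sumKLM n x F = trans (*-distribˡ-sumTo n x _) (sumTo-cong n (λ k → *-distribˡ-sumTo (n ∸ k) x _))

  sumKLM-comm-sumBelow : ∀ n N (f : ℕ → ℕ → ℕ → ℕ → Carrier) →
    sumKLM R n (λ k l m → sumBelow N (λ a → f a k l m)) ≈ sumBelow N (λ a → sumKLM R n (f a))
  sumKLM-comm-sumBelow n N f =
    trans (sumTo-cong n (λ k → sumTo-comm-sumBelow (n ∸ k) N _)) (sumTo-comm-sumBelow n N _)

  sumKLM-comm-sumBelow₃ : ∀ n N₁ N₂ N₃ (F : ℕ → ℕ → ℕ → ℕ → ℕ → ℕ → Carrier) →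
    sumKLM R n (λ k l m → sumBelow N₁ (λ a → sumBelow N₂ (λ b → sumBelow N₃ (λ c → F a b c k l m))))
      ≈ sumBelow N₁ (λ a → sumBelow N₂ (λ b → sumBelow N₃ (λ c → sumKLM R n (F a b c))))
  sumKLM-comm-sumBelow₃ n N₁ N₂ N₃ F = begin
    sumKLM R n (λ k l m → sumBelow N₁ (λ a → sumBelow N₂ (λ b → sumBelow N₃ (λ c → F a b c k l m))))
      ≈⟨ sumKLM-comm-sumBelow n N₁ (λ a k l m → sumBelow N₂ (λ b → sumBelow N₃ (λ c → F a b c k l m))) ⟩
    sumBelow N₁ (λ a → sumKLM R n (λ k l m → sumBelow N₂ (λ b → sumBelow N₃ (λ c → F a b c k l m))))
      ≈⟨ sumBelow-cong N₁ (λ a → sumKLM-comm-sumBelow n N₂ (λ b k l m → sumBelow N₃ (λ c → F a b c k l m))) ⟩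
    sumBelow N₁ (λ a → sumBelow N₂ (λ b → sumKLM R n (λ k l m → sumBelow N₃ (λ c → F a b c k l m))))
      ≈⟨ sumBelow-cong N₁ (λ a → sumBelow-cong N₂ (λ b → sumKLM-comm-sumBelow n N₃ (λ c → F a b c))) ⟩
    sumBelow N₁ (λ a → sumBelow N₂ (λ b → sumBelow N₃ (λ c → sumKLM R n (F a b c)))) ∎

module Multinomial {c ℓ : Level} (R : CommutativeRing c ℓ) where
  open CommutativeRing R
  open CastsAndPowers R
  open FiniteSums R
  open import Relation.Binary.Reasoning.Setoid setoid
  open import Algebra.Solver.Ring.NaturalCoefficients.Default commutativeSemiring
  open import Algebra.Properties.Semiring.Mult semiring using (_×_)
  open import Algebra.Properties.Semiring.Exp semiring using (_^_)
  open import Algebra.Properties.Monoid.Sum +-monoid using (sum)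
  import Algebra.Properties.CommutativeSemiring.Binomial commutativeSemiring as Binomial

  sum≈sumTo : ∀ n (f : ℕ → Carrier) → sum {suc n} (λ i → f (toℕ i)) ≈ sumTo R n f
  sum≈sumTo zero    f = +-identityʳ (f 0)
  sum≈sumTo (suc n) f = trans (+-congˡ (sum≈sumTo n (λ a → f (suc a)))) (sym (sumTo-suc n f))

  binomial-theorem : ∀ n x y →
    pow R (x + y) n ≈ sumTo R n (λ k → fromℕ R (n C k) * (pow R x k * pow R y (n ∸ k)))
  binomial-theorem n x y = begin
    pow R (x + y) n                                    ≈⟨ pow≈^ (x + y) n ⟩
    (x + y) ^ n                                        ≈⟨ Binomial.theorem n x y ⟩
    sum {suc n} (λ i → term (toℕ i))                   ≈⟨ sum≈sumTo n term ⟩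
    sumTo R n term                                     ≈⟨ sumTo-cong n (λ k → trans (×≈fromℕ-* (n C k) _)
                                                            (*-congˡ (sym (*-cong (pow≈^ x k) (pow≈^ y (n ∸ k)))))) ⟩
    sumTo R n (λ k → fromℕ R (n C k) * (pow R x k * pow R y (n ∸ k))) ∎
    where
    term : ℕ → Carrier
    term k = (n C k) × (x ^ k * y ^ (n ∸ k))

  multinomial-theorem : ∀ n x y z →
    pow R (x + (y + z)) n ≈ sumKLM R n (λ k l m → multinomial R n k l * (pow R x k * pow R y l * pow R z m))
  multinomial-theorem n x y z = begin
    pow R (x + (y + z)) n
      ≈⟨ binomial-theorem n x (y + z) ⟩
    sumTo R n (λ k → fromℕ R (n C k) * (pow R x k * pow R (y + z) (n ∸ k)))
      ≈⟨ sumTo-cong n (λ k → *-congˡ (*-congˡ (binomial-theorem (n ∸ k) y z))) ⟩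
    sumTo R n (λ k → fromℕ R (n C k)
      * (pow R x k * sumTo R (n ∸ k) (λ l → fromℕ R ((n ∸ k) C l) * (pow R y l * pow R z (n ∸ k ∸ l)))))
      ≈⟨ sumTo-cong n (λ k → trans (*-congˡ (*-distribˡ-sumTo (n ∸ k) _ _)) (*-distribˡ-sumTo (n ∸ k) _ _)) ⟩
    sumKLM R n (λ k l m → fromℕ R (n C k) * (pow R x k * (fromℕ R ((n ∸ k) C l) * (pow R y l * pow R z m))))
      ≈⟨ sumKLM-cong n (λ k l m → regroup (n C k) ((n ∸ k) C l) (pow R x k) (pow R y l) (pow R z m)) ⟩
    sumKLM R n (λ k l m → multinomial R n k l * (pow R x k * pow R y l * pow R z m)) ∎
    where
    regroup : ∀ a b x y z → fromℕ R a * (x * (fromℕ R b * (y * z))) ≈ fromℕ R (a ℕ.* b) * (x * y * z)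
    regroup a b x y z = trans
      (solve 5 (λ A B x y z → A :* (x :* (B :* (y :* z))) := (A :* B) :* (x :* y :* z)) refl (fromℕ R a) (fromℕ R b) x y z)
      (*-congʳ (sym (fromℕ-* a b)))

  sumKLM-multinomial : ∀ n N₁ N₂ N₃ (f g h X Y Z : ℕ → Carrier) →
    sumKLM R n (λ k l m → multinomial R n k l
      * (sumBelow N₁ (λ a → f a * pow R (X a) k)
         * (sumBelow N₂ (λ b → g b * pow R (Y b) l) * sumBelow N₃ (λ c → h c * pow R (Z c) m))))
      ≈ sumBelow N₁ (λ a → sumBelow N₂ (λ b → sumBelow N₃ (λ c → (f a * (g b * h c)) * pow R (X a + (Y b + Z c)) n)))
  sumKLM-multinomial n N₁ N₂ N₃ f g h X Y Z = begin
    sumKLM R n (λ k l m → M k l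
      * (sumBelow N₁ (λ a → f a * pow R (X a) k)
         * (sumBelow N₂ (λ b → g b * pow R (Y b) l) * sumBelow N₃ (λ c → h c * pow R (Z c) m))))
      ≈⟨ sumKLM-cong n expand ⟩
    sumKLM R n (λ k l m → sumBelow N₁ (λ a → sumBelow N₂ (λ b → sumBelow N₃ (λ c → φ a b c * term a b c k l m))))
      ≈⟨ sumKLM-comm-sumBelow₃ n N₁ N₂ N₃ (λ a b c k l m → φ a b c * term a b c k l m) ⟩
    sumBelow N₁ (λ a → sumBelow N₂ (λ b → sumBelow N₃ (λ c → sumKLM R n (λ k l m → φ a b c * term a b c k l m))))
      ≈⟨ sumBelow-cong N₁ (λ a → sumBelow-cong N₂ (λ b → sumBelow-cong N₃ (λ c → trans
           (sym (*-distribˡ-sumKLM n (φ a b c) (term a b c))) (*-congˡ (sym (multinomial-theorem n (X a) (Y b) (Z c))))))) ⟩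
    sumBelow N₁ (λ a → sumBelow N₂ (λ b → sumBelow N₃ (λ c → φ a b c * pow R (X a + (Y b + Z c)) n))) ∎
    where
    M = multinomial R n
    φ : ℕ → ℕ → ℕ → Carrier
    φ a b c = f a * (g b * h c)
    term : ℕ → ℕ → ℕ → ℕ → ℕ → ℕ → Carrier
    term a b c k l m = M k l * (pow R (X a) k * pow R (Y b) l * pow R (Z c) m)
    expand : ∀ k l m →
      M k l * (sumBelow N₁ (λ a → f a * pow R (X a) k)
               * (sumBelow N₂ (λ b → g b * pow R (Y b) l) * sumBelow N₃ (λ c → h c * pow R (Z c) m)))
        ≈ sumBelow N₁ (λ a → sumBelow N₂ (λ b → sumBelow N₃ (λ c → φ a b c * term a b c k l m)))
    expand k l m = begin
      M k l * (sumBelow N₁ _ * (sumBelow N₂ _ * sumBelow N₃ _))  ≈⟨ *-assoc _ _ _ ⟨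
      (M k l * sumBelow N₁ _) * (sumBelow N₂ _ * sumBelow N₃ _)  ≈⟨ *-congʳ (*-distribˡ-sumBelow N₁ (M k l) _) ⟩
      sumBelow N₁ _ * (sumBelow N₂ _ * sumBelow N₃ _)            ≈⟨ sumBelow-product₃ N₁ N₂ N₃ _ _ _ ⟩
      sumBelow N₁ (λ a → sumBelow N₂ (λ b → sumBelow N₃ (λ c →
        (M k l * (f a * pow R (X a) k)) * ((g b * pow R (Y b) l) * (h c * pow R (Z c) m)))))
        ≈⟨ sumBelow-cong N₁ (λ a → sumBelow-cong N₂ (λ b → sumBelow-cong N₃ (λ c →
             solve 7 (λ μ f x g y h z → (μ :* (f :* x)) :* ((g :* y) :* (h :* z)) := (f :* (g :* h)) :* (μ :* (x :* y :* z))) refl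
               (M k l) (f a) (pow R (X a) k) (g b) (pow R (Y b) l) (h c) (pow R (Z c) m)))) ⟩
      sumBelow N₁ (λ a → sumBelow N₂ (λ b → sumBelow N₃ (λ c → φ a b c * term a b c k l m))) ∎

module ShiftSums {c ℓ : Level} (R : CommutativeRing c ℓ) where
  open CommutativeRing R
  open FiniteSums R
  open import Relation.Binary.Reasoning.Setoid setoid
  open import Algebra.Properties.CommutativeSemigroup *-commutativeSemigroup using () renaming (x∙yz≈y∙xz to x*yz≈y*xz)
  open import Algebra.Properties.CommutativeSemigroup +-commutativeSemigroup using () renaming (x∙yz≈y∙xz to x+yz≈y+xz)

  record ShiftSum : Set c where
    constructor shiftSum
    field
      length : ℕ
      weight : ℕ → Carrier
      offset : ℕ → ℕ

  act : ShiftSum → (ℕ → Carrier) → ℕ → Carrier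
  act (shiftSum n w s) H x = sumBelow n (λ a → w a * H (x ℕ.+ s a))

  act-cong : ∀ o {H H′ : ℕ → Carrier} → (∀ x → H x ≈ H′ x) → ∀ x → act o H x ≈ act o H′ x
  act-cong (shiftSum n w s) H≈H′ x = sumBelow-cong n (λ a → *-congˡ (H≈H′ (x ℕ.+ s a)))

  act-comm : ∀ o o′ H x → act o (act o′ H) x ≈ act o′ (act o H) x
  act-comm (shiftSum n w s) (shiftSum n′ w′ s′) H x = begin
    sumBelow n (λ a → w a * sumBelow n′ (λ b → w′ b * H (x ℕ.+ s a ℕ.+ s′ b)))
      ≈⟨ sumBelow-cong n (λ a → *-distribˡ-sumBelow n′ (w a) _) ⟩
    sumBelow n (λ a → sumBelow n′ (λ b → w a * (w′ b * H (x ℕ.+ s a ℕ.+ s′ b))))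
      ≈⟨ sumBelow-comm n n′ _ ⟩
    sumBelow n′ (λ b → sumBelow n (λ a → w a * (w′ b * H (x ℕ.+ s a ℕ.+ s′ b))))
      ≈⟨ sumBelow-cong n′ (λ b → sumBelow-cong n (λ a → trans (x*yz≈y*xz (w a) (w′ b) _)
           (*-congˡ (*-congˡ (reflexive (≡.cong H (ℕ+.xy∙z≈xz∙y x (s a) (s′ b)))))))) ⟩
    sumBelow n′ (λ b → sumBelow n (λ a → w′ b * (w a * H (x ℕ.+ s′ b ℕ.+ s a))))
      ≈⟨ sumBelow-cong n′ (λ b → sym (*-distribˡ-sumBelow n (w′ b) _)) ⟩
    sumBelow n′ (λ b → w′ b * sumBelow n (λ a → w a * H (x ℕ.+ s′ b ℕ.+ s a))) ∎

  actAll : List ShiftSum → (ℕ → Carrier) → ℕ → Carrier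
  actAll os H = foldr act H os

  actAll-cong : ∀ os {H H′ : ℕ → Carrier} → (∀ x → H x ≈ H′ x) → ∀ x → actAll os H x ≈ actAll os H′ x
  actAll-cong []       H≈H′ = H≈H′
  actAll-cong (o ∷ os) H≈H′ = act-cong o (actAll-cong os H≈H′)

  act-actAll-comm : ∀ o os H x → act o (actAll os H) x ≈ actAll os (act o H) x
  act-actAll-comm o []        H x = refl
  act-actAll-comm o (o′ ∷ os) H x =
    trans (act-comm o o′ (actAll os H) x) (act-cong o′ (act-actAll-comm o os H) x)

  actAll-comm : ∀ os ps H x → actAll os (actAll ps H) x ≈ actAll ps (actAll os H) x
  actAll-comm []       ps H x = refl
  actAll-comm (o ∷ os) ps H x =
    trans (act-cong o (actAll-comm os ps H) x) (act-actAll-comm o ps (actAll os H) x)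

  actAll-++ : ∀ os ps H x → actAll (os ++ ps) H x ≡ actAll os (actAll ps H) x
  actAll-++ os ps H x = ≡.cong-app (ListP.foldr-++ act H os ps) x

  infix 4 _≋_
  record _≋_ (os ps : List ShiftSum) : Set (c ⊔ ℓ) where
    constructor ≋-intro
    field actAll-≈ : ∀ H x → actAll os H x ≈ actAll ps H x
  open _≋_ public

  ++-cong-≋ : ∀ {os os′ ps ps′} → os ≋ os′ → ps ≋ ps′ → (os ++ ps) ≋ (os′ ++ ps′)
  ++-cong-≋ {os} {os′} {ps} {ps′} os≋os′ ps≋ps′ = ≋-intro λ H x → begin
    actAll (os ++ ps) H x        ≡⟨ actAll-++ os ps H x ⟩
    actAll os (actAll ps H) x    ≈⟨ actAll-≈ os≋os′ (actAll ps H) x ⟩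
    actAll os′ (actAll ps H) x   ≈⟨ actAll-cong os′ (actAll-≈ ps≋ps′ H) x ⟩
    actAll os′ (actAll ps′ H) x  ≡⟨ actAll-++ os′ ps′ H x ⟨
    actAll (os′ ++ ps′) H x      ∎

  ++-comm-≋ : ∀ os ps → (os ++ ps) ≋ (ps ++ os)
  ++-comm-≋ os ps = ≋-intro λ H x → begin
    actAll (os ++ ps) H x     ≡⟨ actAll-++ os ps H x ⟩
    actAll os (actAll ps H) x ≈⟨ actAll-comm os ps H x ⟩
    actAll ps (actAll os H) x ≡⟨ actAll-++ ps os H x ⟨
    actAll (ps ++ os) H x     ∎

  -- Shift sums commute, so lists of them, acting by composition, form a commutative monoid
  -- up to ≋; the monoid solver then does all reordering.
  shiftSum-commutativeMonoid : CommutativeMonoid c (c ⊔ ℓ)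
  shiftSum-commutativeMonoid = record
    { Carrier = List ShiftSum
    ; _≈_ = _≋_
    ; _∙_ = _++_
    ; ε = []
    ; isCommutativeMonoid = record
      { isMonoid = record
        { isSemigroup = record
          { isMagma = record
            { isEquivalence = record
              { refl = ≋-intro λ H x → refl
              ; sym = λ os≋ps → ≋-intro λ H x → sym (actAll-≈ os≋ps H x)
              ; trans = λ os≋ps ps≋qs → ≋-intro λ H x → trans (actAll-≈ os≋ps H x) (actAll-≈ ps≋qs H x)
              }
            ; ∙-cong = ++-cong-≋
            }
          ; assoc = λ os ps qs → ≋-intro λ H x → reflexive (≡.cong (λ l → actAll l H x) (ListP.++-assoc os ps qs))
          }
        ; identity = (λ os → ≋-intro λ H x → refl)
                   , (λ os → ≋-intro λ H x → reflexive (≡.cong (λ l → actAll l H x) (ListP.++-identityʳ os)))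
        }
      ; comm = ++-comm-≋
      }
    }

  twisted : (ℕ → Carrier) → ℕ → ℕ → ShiftSum
  twisted e u n = shiftSum n e (u ℕ.*_)

  pairShift : ℕ → ShiftSum
  pairShift v = shiftSum 2 (λ _ → 1#) (ℕ._* v)

  act-pairShift : ∀ v H x → act (pairShift v) H x ≈ H x + H (x ℕ.+ v)
  act-pairShift v H x = begin
    (0# + 1# * H (x ℕ.+ 0)) + 1# * H (x ℕ.+ (v ℕ.+ 0)) ≈⟨ +-cong (+-identityˡ _) refl ⟩
    1# * H (x ℕ.+ 0) + 1# * H (x ℕ.+ (v ℕ.+ 0))        ≈⟨ +-cong (*-identityˡ _) (*-identityˡ _) ⟩
    H (x ℕ.+ 0) + H (x ℕ.+ (v ℕ.+ 0))
      ≡⟨ ≡.cong₂ (λ y z → H y + H (x ℕ.+ z)) (NP.+-identityʳ x) (NP.+-identityʳ v) ⟩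
    H x + H (x ℕ.+ v)                                  ∎

  -- H is built residue class by residue class from H (x + v) = G x - H x.
  pairShift-surjective : ∀ v .{{_ : NonZero v}} (G : ℕ → Carrier) →
    ∃ λ H → ∀ x → act (pairShift v) H x ≈ G x
  pairShift-surjective v@(suc _) G = H , λ x → begin
    act (pairShift v) H x  ≈⟨ act-pairShift v H x ⟩
    H x + H (x ℕ.+ v)      ≈⟨ +-congˡ (reflexive (H-step x)) ⟩
    H x + (G x - H x)      ≈⟨ x+yz≈y+xz (H x) (G x) (- H x) ⟩
    G x + (H x - H x)      ≈⟨ +-congˡ (-‿inverseʳ (H x)) ⟩
    G x + 0#               ≈⟨ +-identityʳ (G x) ⟩
    G x                    ∎
    where
    h : ℕ → ℕ → Carrier
    h r zero    = 0#
    h r (suc q) = G (r ℕ.+ q ℕ.* v) - h r q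
    H : ℕ → Carrier
    H x = h (x % v) (x / v)
    H-step : ∀ x → H (x ℕ.+ v) ≡ G x - H x
    H-step x = ≡.trans (≡.cong₂ h ([m+n]%n≡m%n x v) quotient-suc)
                       (≡.cong (λ y → G y - H x) (≡.sym (m≡m%n+[m/n]*n x v)))
      where
      quotient-suc : (x ℕ.+ v) / v ≡ suc (x / v)
      quotient-suc = ≡.trans (m/n≡1+[m∸n]/n (NP.m≤n+m v x)) (≡.cong (λ y → suc (y / v)) (NP.m+n∸n≡m x v))

module _ {c ℓ : Level} (R : CommutativeRing c ℓ) where
  open CommutativeRing R

  Antiperiodic : (ℕ → Carrier) → ℕ → Set ℓ
  Antiperiodic e d = ∀ a → e (a ℕ.+ d) ≈ - e a

module Telescoping {c ℓ : Level} (R : CommutativeRing c ℓ)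
  (e : ℕ → CommutativeRing.Carrier R) (d : ℕ) (e-antiperiodic : Antiperiodic R e d) where
  open CommutativeRing R
  open CastsAndPowers R
  open FiniteSums R
  open ShiftSums R
  open import Relation.Binary.Reasoning.Setoid setoid
  open import Algebra.Properties.Ring ring using (-1*x≈-x; -‿distribˡ-*)

  e-shift : ∀ w r → e (w ℕ.* d ℕ.+ r) ≈ pow R (- 1#) w * e r
  e-shift zero    r = sym (*-identityˡ (e r))
  e-shift (suc w) r = begin
    e (d ℕ.+ w ℕ.* d ℕ.+ r)             ≡⟨ ≡.cong e (ℕ+.xy∙z≈yz∙x d (w ℕ.* d) r) ⟩
    e (w ℕ.* d ℕ.+ r ℕ.+ d)             ≈⟨ e-antiperiodic (w ℕ.* d ℕ.+ r) ⟩
    - e (w ℕ.* d ℕ.+ r)                 ≈⟨ -‿cong (e-shift w r) ⟩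
    - (pow R (- 1#) w * e r)            ≈⟨ -1*x≈-x _ ⟨
    - 1# * (pow R (- 1#) w * e r)       ≈⟨ *-assoc _ _ _ ⟨
    pow R (- 1#) (suc w) * e r          ∎

  e-shift-odd : ∀ {w} → Odd w → ∀ r → e (w ℕ.* d ℕ.+ r) ≈ - e r
  e-shift-odd {w} w-odd r = trans (e-shift w r) (trans (*-congʳ (pow-neg-1#-odd w-odd)) (-1*x≈-x (e r)))

  -- Antiperiodicity cancels e a * J (a + d) against the first term of the next block of length d.
  telescope : ∀ w (J : ℕ → Carrier) →
    sumBelow (w ℕ.* d) (λ a → e a * (J a + J (a ℕ.+ d))) + sumBelow d (λ r → e (w ℕ.* d ℕ.+ r) * J (w ℕ.* d ℕ.+ r))
      ≈ sumBelow d (λ r → e r * J r)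
  telescope zero    J = +-identityˡ (sumBelow d (λ r → e r * J r))
  telescope (suc w) J = begin
    sumBelow (d ℕ.+ w ℕ.* d) f + tail (suc w)
      ≡⟨ ≡.cong (λ n → sumBelow n f + tail (suc w)) (NP.+-comm d (w ℕ.* d)) ⟩
    sumBelow (w ℕ.* d ℕ.+ d) f + tail (suc w)
      ≈⟨ +-congʳ (sumBelow-split (w ℕ.* d) d f) ⟩
    (sumBelow (w ℕ.* d) f + sumBelow d (λ r → f (w ℕ.* d ℕ.+ r))) + tail (suc w)
      ≈⟨ +-assoc _ _ _ ⟩
    sumBelow (w ℕ.* d) f + (sumBelow d (λ r → f (w ℕ.* d ℕ.+ r)) + tail (suc w))
      ≈⟨ +-congˡ (sumBelow-distrib-+ d _ _) ⟨
    sumBelow (w ℕ.* d) f + sumBelow d (λ r → f (w ℕ.* d ℕ.+ r) + e (d ℕ.+ w ℕ.* d ℕ.+ r) * J (d ℕ.+ w ℕ.* d ℕ.+ r))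
      ≈⟨ +-congˡ (sumBelow-cong d (λ r → block (w ℕ.* d ℕ.+ r) (ℕ+.xy∙z≈yz∙x d (w ℕ.* d) r))) ⟩
    sumBelow (w ℕ.* d) f + tail w
      ≈⟨ telescope w J ⟩
    sumBelow d (λ r → e r * J r) ∎
    where
    f : ℕ → Carrier
    f a = e a * (J a + J (a ℕ.+ d))
    tail : ℕ → Carrier
    tail n = sumBelow d (λ r → e (n ℕ.* d ℕ.+ r) * J (n ℕ.* d ℕ.+ r))
    block : ∀ b {b′} → b′ ≡ b ℕ.+ d → f b + e b′ * J b′ ≈ e b * J b
    block b ≡.refl = begin
      e b * (J b + J (b ℕ.+ d)) + e (b ℕ.+ d) * J (b ℕ.+ d)   ≈⟨ +-cong (distribˡ _ _ _) (*-congʳ (e-antiperiodic b)) ⟩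
      (e b * J b + e b * J (b ℕ.+ d)) + - e b * J (b ℕ.+ d)   ≈⟨ +-assoc _ _ _ ⟩
      e b * J b + (e b * J (b ℕ.+ d) + - e b * J (b ℕ.+ d))   ≈⟨ +-congˡ (+-congˡ (-‿distribˡ-* _ _)) ⟨
      e b * J b + (e b * J (b ℕ.+ d) - e b * J (b ℕ.+ d))     ≈⟨ +-congˡ (-‿inverseʳ _) ⟩
      e b * J b + 0#                                          ≈⟨ +-identityʳ _ ⟩
      e b * J b                                               ∎

  telescope-odd : ∀ {w} → Odd w → ∀ (J : ℕ → Carrier) →
    sumBelow (w ℕ.* d) (λ a → e a * (J a + J (a ℕ.+ d))) ≈ sumBelow d (λ r → e r * (J r + J (r ℕ.+ w ℕ.* d)))
  telescope-odd {w} w-odd J = begin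
    X                        ≈⟨ +-identityʳ X ⟨
    X + 0#                   ≈⟨ +-congˡ tail+Y≈0 ⟨
    X + (tail + Y)           ≈⟨ +-assoc X tail Y ⟨
    (X + tail) + Y           ≈⟨ +-congʳ (telescope w J) ⟩
    sumBelow d (λ r → e r * J r) + Y ≈⟨ sumBelow-distrib-+ d _ _ ⟨
    sumBelow d (λ r → e r * J r + e r * J (r ℕ.+ w ℕ.* d)) ≈⟨ sumBelow-cong d (λ r → distribˡ (e r) _ _) ⟨
    sumBelow d (λ r → e r * (J r + J (r ℕ.+ w ℕ.* d))) ∎
    where
    X = sumBelow (w ℕ.* d) (λ a → e a * (J a + J (a ℕ.+ d)))
    tail = sumBelow d (λ r → e (w ℕ.* d ℕ.+ r) * J (w ℕ.* d ℕ.+ r))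
    Y = sumBelow d (λ r → e r * J (r ℕ.+ w ℕ.* d))
    cancel : ∀ r → e (w ℕ.* d ℕ.+ r) * J (w ℕ.* d ℕ.+ r) + e r * J (r ℕ.+ w ℕ.* d) ≈ 0#
    cancel r = begin
      e (w ℕ.* d ℕ.+ r) * J (w ℕ.* d ℕ.+ r) + e r * J (r ℕ.+ w ℕ.* d)
        ≈⟨ +-cong (*-cong (e-shift-odd w-odd r) (reflexive (≡.cong J (NP.+-comm (w ℕ.* d) r)))) refl ⟩
      - e r * J (r ℕ.+ w ℕ.* d) + e r * J (r ℕ.+ w ℕ.* d)
        ≈⟨ +-congʳ (-‿distribˡ-* _ _) ⟨
      - (e r * J (r ℕ.+ w ℕ.* d)) + e r * J (r ℕ.+ w ℕ.* d)
        ≈⟨ -‿inverseˡ _ ⟩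
      0# ∎
    tail+Y≈0 : tail + Y ≈ 0#
    tail+Y≈0 = trans (sym (sumBelow-distrib-+ d _ _)) (trans (sumBelow-cong d cancel) (sumBelow-zero d))

  twisted-pairShift : ∀ {w} → Odd w → ∀ u →
    twisted e u (w ℕ.* d) ∷ pairShift (u ℕ.* d) ∷ [] ≋ twisted e u d ∷ pairShift (u ℕ.* (w ℕ.* d)) ∷ []
  twisted-pairShift {w} w-odd u = ≋-intro telescoped
    where
    telescoped : ∀ H x → sumBelow (w ℕ.* d) (λ a → e a * act (pairShift (u ℕ.* d)) H (x ℕ.+ u ℕ.* a))
                       ≈ sumBelow d (λ r → e r * act (pairShift (u ℕ.* (w ℕ.* d))) H (x ℕ.+ u ℕ.* r))
    telescoped H x = begin
      sumBelow (w ℕ.* d) (λ a → e a * act (pairShift (u ℕ.* d)) H (x ℕ.+ u ℕ.* a))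
        ≈⟨ sumBelow-cong (w ℕ.* d) (λ a → *-congˡ (pair a d)) ⟩
      sumBelow (w ℕ.* d) (λ a → e a * (J a + J (a ℕ.+ d)))
        ≈⟨ telescope-odd w-odd J ⟩
      sumBelow d (λ r → e r * (J r + J (r ℕ.+ w ℕ.* d)))
        ≈⟨ sumBelow-cong d (λ r → *-congˡ (pair r (w ℕ.* d))) ⟨
      sumBelow d (λ r → e r * act (pairShift (u ℕ.* (w ℕ.* d))) H (x ℕ.+ u ℕ.* r)) ∎
      where
      J : ℕ → Carrier
      J a = H (x ℕ.+ u ℕ.* a)
      pair : ∀ a b → act (pairShift (u ℕ.* b)) H (x ℕ.+ u ℕ.* a) ≈ J a + J (a ℕ.+ b)
      pair a b = trans (act-pairShift (u ℕ.* b) H _) (+-congˡ (reflexive (≡.cong H (x+ua+ub≡x+u[a+b] x u a b))))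

module TripleSymmetry {c ℓ : Level} (R : CommutativeRing c ℓ)
  (e : ℕ → CommutativeRing.Carrier R) (d : ℕ) .{{_ : NonZero d}} (e-antiperiodic : Antiperiodic R e d) where
  open CommutativeRing R using (Carrier; _≈_; sym; trans)
  open ShiftSums R
  open Telescoping R e d e-antiperiodic using (twisted-pairShift)
  open CommutativeMonoid shiftSum-commutativeMonoid using (∙-cong) renaming (refl to ≋-refl; setoid to ≋-setoid)
  open import Relation.Binary.Reasoning.Setoid ≋-setoid
  open import Algebra.Solver.CommutativeMonoid shiftSum-commutativeMonoid using (solve; _⊕_; _⊜_)

  [twisted] : ℕ → ℕ → List ShiftSum
  [twisted] u n = twisted e u n ∷ []

  [pairShift] : ℕ → List ShiftSum
  [pairShift] v = pairShift v ∷ []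

  pairShifts : ℕ → ℕ → ℕ → List ShiftSum
  pairShifts w₁ w₂ w₃ = [pairShift] (w₁ ℕ.* d) ++ [pairShift] (w₂ ℕ.* d) ++ [pairShift] (w₃ ℕ.* d)

  twisted-pairShifts-symmetric : ∀ {w₁ w₂ w₃} → Odd w₁ → Odd w₂ → Odd w₃ →
    ([twisted] w₃ (w₁ ℕ.* d) ++ [twisted] w₁ (w₂ ℕ.* d) ++ [twisted] w₂ (w₃ ℕ.* d)) ++ pairShifts w₁ w₂ w₃
      ≋ ([twisted] w₂ (w₁ ℕ.* d) ++ [twisted] w₁ (w₃ ℕ.* d) ++ [twisted] w₃ (w₂ ℕ.* d)) ++ pairShifts w₁ w₂ w₃
  twisted-pairShifts-symmetric {w₁} {w₂} {w₃} o₁ o₂ o₃ = begin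
    (T₃₁ ++ T₁₂ ++ T₂₃) ++ (P₁ ++ P₂ ++ P₃)
      ≈⟨ solve 6 (λ a b c p q r → (a ⊕ b ⊕ c) ⊕ (p ⊕ q ⊕ r) ⊜ (a ⊕ r) ⊕ (b ⊕ p) ⊕ (c ⊕ q)) ≋-refl
           T₃₁ T₁₂ T₂₃ P₁ P₂ P₃ ⟩
    (T₃₁ ++ P₃) ++ (T₁₂ ++ P₁) ++ (T₂₃ ++ P₂)
      ≈⟨ ∙-cong (telescoped w₃ o₁ ≡.refl) (∙-cong (telescoped w₁ o₂ ≡.refl) (telescoped w₂ o₃ ≡.refl)) ⟩
    ([twisted] w₃ d ++ P₃₁) ++ ([twisted] w₁ d ++ P₁₂) ++ ([twisted] w₂ d ++ P₂₃)
      ≈⟨ solve 6 (λ a b c p q r → (a ⊕ p) ⊕ (b ⊕ q) ⊕ (c ⊕ r) ⊜ (c ⊕ q) ⊕ (b ⊕ p) ⊕ (a ⊕ r)) ≋-refl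
           ([twisted] w₃ d) ([twisted] w₁ d) ([twisted] w₂ d) P₃₁ P₁₂ P₂₃ ⟩
    ([twisted] w₂ d ++ P₁₂) ++ ([twisted] w₁ d ++ P₃₁) ++ ([twisted] w₃ d ++ P₂₃)
      ≈⟨ ∙-cong (telescoped w₂ o₁ (ℕ*.x∙yz≈y∙xz w₁ w₂ d))
           (∙-cong (telescoped w₁ o₃ (ℕ*.x∙yz≈y∙xz w₃ w₁ d)) (telescoped w₃ o₂ (ℕ*.x∙yz≈y∙xz w₂ w₃ d))) ⟨
    (T₂₁ ++ P₂) ++ (T₁₃ ++ P₁) ++ (T₃₂ ++ P₃)
      ≈⟨ solve 6 (λ a b c p q r → (a ⊕ b ⊕ c) ⊕ (p ⊕ q ⊕ r) ⊜ (a ⊕ q) ⊕ (b ⊕ p) ⊕ (c ⊕ r)) ≋-refl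
           T₂₁ T₁₃ T₃₂ P₁ P₂ P₃ ⟨
    (T₂₁ ++ T₁₃ ++ T₃₂) ++ (P₁ ++ P₂ ++ P₃) ∎
    where
    T₃₁ = [twisted] w₃ (w₁ ℕ.* d)
    T₁₂ = [twisted] w₁ (w₂ ℕ.* d)
    T₂₃ = [twisted] w₂ (w₃ ℕ.* d)
    T₂₁ = [twisted] w₂ (w₁ ℕ.* d)
    T₁₃ = [twisted] w₁ (w₃ ℕ.* d)
    T₃₂ = [twisted] w₃ (w₂ ℕ.* d)
    P₁ = [pairShift] (w₁ ℕ.* d)
    P₂ = [pairShift] (w₂ ℕ.* d)
    P₃ = [pairShift] (w₃ ℕ.* d)
    P₃₁ = [pairShift] (w₃ ℕ.* (w₁ ℕ.* d))
    P₁₂ = [pairShift] (w₁ ℕ.* (w₂ ℕ.* d))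
    P₂₃ = [pairShift] (w₂ ℕ.* (w₃ ℕ.* d))
    telescoped : ∀ u {w v} → Odd w → v ≡ u ℕ.* (w ℕ.* d) →
      [twisted] u (w ℕ.* d) ++ [pairShift] (u ℕ.* d) ≋ [twisted] u d ++ [pairShift] v
    telescoped u w-odd ≡.refl = twisted-pairShift w-odd u

  pairShifts-surjective : ∀ {w₁ w₂ w₃} → Odd w₁ → Odd w₂ → Odd w₃ → (G : ℕ → Carrier) →
    ∃ λ H → ∀ x → actAll (pairShifts w₁ w₂ w₃) H x ≈ G x
  pairShifts-surjective {w₁} {w₂} {w₃} (_ , ≡.refl) (_ , ≡.refl) (_ , ≡.refl) G =
    let H₁ , s₁ = pairShift-surjective (w₁ ℕ.* d) {{m*n≢0 w₁ d}} G
        H₂ , s₂ = pairShift-surjective (w₂ ℕ.* d) {{m*n≢0 w₂ d}} H₁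
        H₃ , s₃ = pairShift-surjective (w₃ ℕ.* d) {{m*n≢0 w₃ d}} H₂
    in H₃ , λ x → trans (act-cong (pairShift (w₁ ℕ.* d)) (λ y → trans (act-cong (pairShift (w₂ ℕ.* d)) s₃ y) (s₂ y)) x)
                        (s₁ x)

  twisted-triple-symmetric : ∀ {w₁ w₂ w₃} → Odd w₁ → Odd w₂ → Odd w₃ →
    [twisted] w₃ (w₁ ℕ.* d) ++ [twisted] w₁ (w₂ ℕ.* d) ++ [twisted] w₂ (w₃ ℕ.* d)
      ≋ [twisted] w₂ (w₁ ℕ.* d) ++ [twisted] w₁ (w₃ ℕ.* d) ++ [twisted] w₃ (w₂ ℕ.* d)
  twisted-triple-symmetric {w₁} {w₂} {w₃} o₁ o₂ o₃ = ≋-intro symmetric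
    where
    L = [twisted] w₃ (w₁ ℕ.* d) ++ [twisted] w₁ (w₂ ℕ.* d) ++ [twisted] w₂ (w₃ ℕ.* d)
    L′ = [twisted] w₂ (w₁ ℕ.* d) ++ [twisted] w₁ (w₃ ℕ.* d) ++ [twisted] w₃ (w₂ ℕ.* d)
    symmetric : ∀ F x → actAll L F x ≈ actAll L′ F x
    symmetric F x with H , F≈ ← pairShifts-surjective o₁ o₂ o₃ F =
      trans (actAll-cong L (λ y → sym (F≈ y)) x)
            (trans (actAll-≈ (twisted-pairShifts-symmetric o₁ o₂ o₃) H x) (actAll-cong L′ F≈ x))

module TwistedPowerSums {c ℓ : Level} (R : CommutativeRing c ℓ) (χ : ℕ → CommutativeRing.Carrier R) where
  open CommutativeRing R
  open CastsAndPowers R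
  open FiniteSums R
  open Multinomial R using (sumKLM-multinomial)
  open ShiftSums R
  open import Relation.Binary.Reasoning.Setoid setoid
  open import Algebra.Solver.Ring.NaturalCoefficients.Default commutativeSemiring
  open import Algebra.Properties.Ring ring using (-1*x≈-x; -‿distribˡ-*)

  ε : ℕ → Carrier
  ε a = pow R (- 1#) a * χ a

  ε-antiperiodic : ∀ {d} → Odd d → (∀ a → χ (a ℕ.+ d) ≈ χ a) → Antiperiodic R ε d
  ε-antiperiodic {d} d-odd χ-periodic a = begin
    pow R (- 1#) (a ℕ.+ d) * χ (a ℕ.+ d)     ≈⟨ *-cong (pow-+ (- 1#) a d) (χ-periodic a) ⟩
    (pow R (- 1#) a * pow R (- 1#) d) * χ a  ≈⟨ *-congʳ (*-congˡ (pow-neg-1#-odd d-odd)) ⟩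
    (pow R (- 1#) a * - 1#) * χ a            ≈⟨ *-congʳ (trans (*-comm _ _) (-1*x≈-x _)) ⟩
    - pow R (- 1#) a * χ a                   ≈⟨ -‿distribˡ-* _ _ ⟨
    - ε a                                     ∎

  twistedPower : Carrier → ℕ → ℕ → Carrier
  twistedPower ξ n y = pow R ξ y * pow R (fromℕ R y) n

  T-dilate : ∀ ξ k N u → T R k N χ (pow R ξ u) * pow R (fromℕ R u) k
    ≈ sumBelow (suc N) (λ a → (ε a * pow R ξ (u ℕ.* a)) * pow R (fromℕ R (u ℕ.* a)) k)
  T-dilate ξ k N u = begin
    T R k N χ (pow R ξ u) * pow R (fromℕ R u) k
      ≈⟨ *-congʳ (sumTo≈sumBelow N _) ⟩
    sumBelow (suc N) (λ a → ε a * pow R (pow R ξ u) a * pow R (fromℕ R a) k) * pow R (fromℕ R u) k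
      ≈⟨ *-distribʳ-sumBelow (suc N) _ _ ⟩
    sumBelow (suc N) (λ a → ε a * pow R (pow R ξ u) a * pow R (fromℕ R a) k * pow R (fromℕ R u) k)
      ≈⟨ sumBelow-cong (suc N) (λ a → trans (*-assoc _ _ _) (*-cong (*-congˡ (pow-pow ξ u a)) (dilate a))) ⟩
    sumBelow (suc N) (λ a → (ε a * pow R ξ (u ℕ.* a)) * pow R (fromℕ R (u ℕ.* a)) k) ∎
    where
    dilate : ∀ a → pow R (fromℕ R a) k * pow R (fromℕ R u) k ≈ pow R (fromℕ R (u ℕ.* a)) k
    dilate a = trans (*-comm _ _) (trans (sym (pow-distrib-* _ _ k)) (pow-cong k (sym (fromℕ-* u a))))

  sumKLM-T-products : ∀ ξ n N₁ N₂ N₃ u₁ u₂ u₃ →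
    sumKLM R n (λ k l m → multinomial R n k l
      * T R k N₁ χ (pow R ξ u₁) * T R l N₂ χ (pow R ξ u₂) * T R m N₃ χ (pow R ξ u₃)
      * pow R (fromℕ R u₁) k * pow R (fromℕ R u₂) l * pow R (fromℕ R u₃) m)
      ≈ actAll (twisted ε u₁ (suc N₁) ∷ twisted ε u₂ (suc N₂) ∷ twisted ε u₃ (suc N₃) ∷ [])
               (twistedPower ξ n) 0
  sumKLM-T-products ξ n N₁ N₂ N₃ u₁ u₂ u₃ = begin
    sumKLM R n (λ k l m → multinomial R n k l
      * T R k N₁ χ (pow R ξ u₁) * T R l N₂ χ (pow R ξ u₂) * T R m N₃ χ (pow R ξ u₃)
      * pow R (fromℕ R u₁) k * pow R (fromℕ R u₂) l * pow R (fromℕ R u₃) m)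
      ≈⟨ sumKLM-cong n (λ k l m → trans (regroup (multinomial R n k l) _ _ _ _ _ _)
           (*-congˡ (*-cong (T-dilate ξ k N₁ u₁) (*-cong (T-dilate ξ l N₂ u₂) (T-dilate ξ m N₃ u₃))))) ⟩
    _ ≈⟨ sumKLM-multinomial n (suc N₁) (suc N₂) (suc N₃) (f u₁) (f u₂) (f u₃) (X u₁) (X u₂) (X u₃) ⟩
    _ ≈⟨ sumBelow-cong (suc N₁) (λ a → sumBelow-cong (suc N₂) (λ b → sumBelow-cong (suc N₃) (λ c → collect a b c))) ⟩
    _ ≈⟨ sumBelow-factor₃ (suc N₁) (suc N₂) (suc N₃) ε ε ε _ ⟩
    actAll (twisted ε u₁ (suc N₁) ∷ twisted ε u₂ (suc N₂) ∷ twisted ε u₃ (suc N₃) ∷ [])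
           (twistedPower ξ n) 0 ∎
    where
    f X : ℕ → ℕ → Carrier
    f u a = ε a * pow R ξ (u ℕ.* a)
    X u a = fromℕ R (u ℕ.* a)
    regroup : ∀ μ t₁ t₂ t₃ p₁ p₂ p₃ → μ * t₁ * t₂ * t₃ * p₁ * p₂ * p₃ ≈ μ * ((t₁ * p₁) * ((t₂ * p₂) * (t₃ * p₃)))
    regroup = solve 7 (λ μ t₁ t₂ t₃ p₁ p₂ p₃ →
      μ :* t₁ :* t₂ :* t₃ :* p₁ :* p₂ :* p₃ := μ :* ((t₁ :* p₁) :* ((t₂ :* p₂) :* (t₃ :* p₃)))) refl
    collect : ∀ a b c → (f u₁ a * (f u₂ b * f u₃ c)) * pow R (X u₁ a + (X u₂ b + X u₃ c)) n
      ≈ ε a * (ε b * (ε c * twistedPower ξ n (u₁ ℕ.* a ℕ.+ u₂ ℕ.* b ℕ.+ u₃ ℕ.* c)))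
    collect a b c = begin
      (f u₁ a * (f u₂ b * f u₃ c)) * pow R (X u₁ a + (X u₂ b + X u₃ c)) n
        ≈⟨ solve 7 (λ ea eb ec za zb zc P → ((ea :* za) :* ((eb :* zb) :* (ec :* zc))) :* P
                      := ea :* (eb :* (ec :* (((za :* zb) :* zc) :* P)))) refl
             (ε a) (ε b) (ε c) (pow R ξ A) (pow R ξ B) (pow R ξ C) _ ⟩
      ε a * (ε b * (ε c * (((pow R ξ A * pow R ξ B) * pow R ξ C) * pow R (X u₁ a + (X u₂ b + X u₃ c)) n)))
        ≈⟨ *-congˡ (*-congˡ (*-congˡ (*-cong ξ-powers (pow-cong n casts)))) ⟨
      ε a * (ε b * (ε c * (pow R ξ (A ℕ.+ B ℕ.+ C) * pow R (fromℕ R (A ℕ.+ B ℕ.+ C)) n))) ∎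
      where
      A = u₁ ℕ.* a
      B = u₂ ℕ.* b
      C = u₃ ℕ.* c
      ξ-powers : pow R ξ (A ℕ.+ B ℕ.+ C) ≈ (pow R ξ A * pow R ξ B) * pow R ξ C
      ξ-powers = trans (pow-+ ξ (A ℕ.+ B) C) (*-congʳ (pow-+ ξ A B))
      casts : fromℕ R (A ℕ.+ B ℕ.+ C) ≈ fromℕ R A + (fromℕ R B + fromℕ R C)
      casts = trans (fromℕ-+ (A ℕ.+ B) C) (trans (+-congʳ (fromℕ-+ A B)) (+-assoc _ _ _))

open import Data.Nat using (ℕ; suc; _*_; _^_; _≤_; _∸_)
open import Data.Nat.Primality using (Prime)

-- Matching the oddness witnesses makes each wᵢ * d a successor, so suc (wᵢ * d ∸ 1) reduces to wᵢ * d.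
theorem8 : ∀ {c ℓ : Level} (R : CommutativeRing c ℓ)
    → IsFieldR R → CharZero R
    → (p : ℕ) → Prime p → Odd p
    → (s : ℕ) → 1 ≤ s → (ξ : CommutativeRing.Carrier R) → CommutativeRing._≈_ R (pow R ξ (p ^ s)) (CommutativeRing.1# R)
    → (d : ℕ) → Odd d → (χ : ℕ → CommutativeRing.Carrier R) → IsPrimitiveChar R d χ
    → (w₁ w₂ w₃ : ℕ) → Odd w₁ → Odd w₂ → Odd w₃
    → (n : ℕ)
    → CommutativeRing._≈_ R
        (sumKLM R n (λ k l m → CommutativeRing._*_ R (CommutativeRing._*_ R (CommutativeRing._*_ R (CommutativeRing._*_ R (CommutativeRing._*_ R (CommutativeRing._*_ R
          (multinomial R n k l)
          (T R k (w₁ * d ∸ 1) χ (pow R ξ w₃)))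
          (T R l (w₂ * d ∸ 1) χ (pow R ξ w₁)))
          (T R m (w₃ * d ∸ 1) χ (pow R ξ w₂)))
          (pow R (fromℕ R w₃) k))
          (pow R (fromℕ R w₁) l))
          (pow R (fromℕ R w₂) m)))
        (sumKLM R n (λ k l m → CommutativeRing._*_ R (CommutativeRing._*_ R (CommutativeRing._*_ R (CommutativeRing._*_ R (CommutativeRing._*_ R (CommutativeRing._*_ R
          (multinomial R n k l)
          (T R k (w₁ * d ∸ 1) χ (pow R ξ w₂)))
          (T R l (w₃ * d ∸ 1) χ (pow R ξ w₁)))
          (T R m (w₂ * d ∸ 1) χ (pow R ξ w₃)))
          (pow R (fromℕ R w₂) k))
          (pow R (fromℕ R w₁) l))
          (pow R (fromℕ R w₃) m)))
theorem8 R _ _ _ _ _ _ _ ξ _ d d-odd@(_ , ≡.refl) χ χ-primitive w₁ w₂ w₃ w₁-odd@(_ , ≡.refl) w₂-odd@(_ , ≡.refl) w₃-odd@(_ , ≡.refl) n =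
  trans (sumKLM-T-products ξ n (w₁ * d ∸ 1) (w₂ * d ∸ 1) (w₃ * d ∸ 1) w₃ w₁ w₂)
    (trans (actAll-≈ (twisted-triple-symmetric w₁-odd w₂-odd w₃-odd) (twistedPower ξ n) 0)
      (sym (sumKLM-T-products ξ n (w₁ * d ∸ 1) (w₃ * d ∸ 1) (w₂ * d ∸ 1) w₂ w₁ w₃)))
  where
  open CommutativeRing R using (trans; sym)
  open TwistedPowerSums R χ
  open ShiftSums R using (actAll-≈)
  open TripleSymmetry R ε d (ε-antiperiodic d-odd (IsDirichletChar.periodic (IsPrimitiveChar.isChar χ-primitive)))
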